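{- Let $n$ be even and let $X = \mathrm{Cay}(\mathbb{Z}_n, S)$ be a circulant graph. If $X \cong \mathrm{Cay}(\mathbb{Z}_n, S + (n/2))$, then $X$ is unstable.
   Context: All graphs are finite, simple and undirected. For an abelian group $G$ and $S \subseteq G$ with $-S = S$, $0 \notin S$, $\mathrm{Cay}(G,S)$ has vertex set $G$ with $v \sim w$ iff $w - v \in S$; $S + (n/2) = \{s + n/2 : s \in S\}$. The canonical bipartite double cover $BX$ of $X$ has vertex set $V(X) \times \{0,1\}$, with $(v,0)$ adjacent to $(w,1)$ iff $v \sim w$ in $X$. The group $\mathrm{Aut}\,X \times S_2$ embeds in $\mathrm{Aut}\,BX$ via $(\varphi,\sigma)(v,i) = (\varphi(v),\sigma(i))$. $X$ is unstable if $\mathrm{Aut}\,BX \neq \mathrm{Aut}\,X \times S_2$. -}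

module Defs where

open import Data.Nat using (ℕ; suc; _+_; _∸_; NonZero)
open import Data.Nat.DivMod using (_mod_)
open import Data.Fin using (Fin; toℕ; zero)
import Data.Fin
open import Data.Bool using (Bool; true; false)
open import Data.Product using (_×_; _,_; Σ; ∃)
open import Relation.Binary.PropositionalEquality using (_≡_; _≢_)
open import Relation.Nullary using (¬_)
open import Function.Bundles using (Bijection; _⤖_)
open import Level using (0ℓ)

record Graph : Set₁ where
  field
    V   : Set
    adj : V → V → Set
open Graph public

module _ (n : ℕ) .{{_ : NonZero n}} where
  _⊕_ : Fin n → Fin n → Fin n
  a ⊕ b = (toℕ a + toℕ b) mod n

  𝟘 : Fin n
  𝟘 = 0 mod n

  _⊖_ : Fin n → Fin n → Fin n
  a ⊖ b = (toℕ a + (n ∸ toℕ b)) mod n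

  IsConnectionSet : (Fin n → Bool) → Set
  IsConnectionSet S = (S 𝟘 ≡ false) × (∀ x → S x ≡ S (𝟘 ⊖ x))

  Cay : (Fin n → Bool) → Graph
  Cay S = record { V = Fin n ; adj = λ v w → S (w ⊖ v) ≡ true }

  -- S + c = { s + c : s ∈ S }, i.e. x ∈ S + c iff x - c ∈ S
  shift : (Fin n → Bool) → Fin n → (Fin n → Bool)
  shift S c x = S (x ⊖ c)

Iso : (X Y : Graph) → Set
Iso X Y = Σ (V X ⤖ V Y) λ f →
  ∀ v w → (adj X v w → adj Y (Bijection.to f v) (Bijection.to f w))
        × (adj Y (Bijection.to f v) (Bijection.to f w) → adj X v w)

_≅_ : Graph → Graph → Set
X ≅ Y = Iso X Y

Aut : Graph → Set
Aut X = Iso X X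

B : Graph → Graph
B X = record { V = V X × Bool
             ; adj = λ { (v , i) (w , j) → (i ≢ j) × adj X v w } }

InAutXtimesS2 : (X : Graph) → Aut (B X) → Set
InAutXtimesS2 X ψ = Σ (Aut X) λ φ → Σ (Bool ⤖ Bool) λ σ →
  ∀ v i → Bijection.to (Σ.proj₁ ψ) (v , i)
          ≡ (Bijection.to (Σ.proj₁ φ) v , Bijection.to σ i)

-- X is unstable iff Aut BX ≠ Aut X × S₂, i.e. some automorphism of BX
-- is not of the form (φ , σ).
Unstable : Graph → Set
Unstable X = Σ (Aut (B X)) λ ψ → ¬ InAutXtimesS2 X ψ

-- for n = h + h with h = suc k: the element n/2 = h of ℤ_n
open import Data.Nat.Properties using (m<m+n)
open import Data.Nat using (z<s)
half : (k : ℕ) → Fin (suc k + suc k)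
half k = Data.Fin.fromℕ< (m<m+n (suc k) z<s)

{-# OPTIONS --safe #-}
module Submission where

open import Defs
open import Level using (0ℓ)
open import Data.Nat using (ℕ; suc; _+_; _∸_; NonZero; >-nonZero⁻¹; z<s)
open import Data.Nat.Properties using (+-comm; +-assoc; m+[n∸m]≡n; <⇒≤; m<m+n)
open import Data.Nat.DivMod using (_%_; _mod_; %-distribˡ-+; m%n<n; m<n⇒m%n≡m; n%n≡0)
open import Data.Fin using (Fin; toℕ)
open import Data.Fin.Properties using (toℕ-injective; toℕ-fromℕ<; toℕ<n)
open import Data.Bool using (Bool; true; false)
open import Data.Product using (_×_; _,_; proj₁; proj₂; ∃)
open import Data.Empty using (⊥-elim)
open import Relation.Binary.PropositionalEquality
  using (_≡_; _≢_; refl; sym; trans; cong; cong₂; subst; isEquivalence; module ≡-Reasoning)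
open import Function.Bundles using (Bijection; _⤖_; mk⤖; _⇔_; mk⇔; Equivalence; mk↔ₛ′)
open import Function.Properties.Inverse using (↔⇒⤖)
open import Function.Construct.Composition using (_⤖-∘_)
open import Algebra.Bundles using (AbelianGroup)
open import Algebra.Structures using (IsAbelianGroup)
import Algebra.Properties.AbelianGroup as AbelianGroupProperties
import Relation.Binary.Reasoning.Setoid as SetoidReasoning

open Bijection using (to)

-- Let f : Cay(S) ≅ Cay(S + n/2). Then (v, 0) ↦ (f v, 0), (v, 1) ↦ (f v + n/2, 1)
-- is an automorphism of the double cover: since n/2 = -n/2, both
-- (f w + n/2) - f v and f w - (f v + n/2) equal f w - f v - n/2, which lies in S
-- exactly when w - v does. It moves the two copies of a vertex by different
-- bijections, so it is not of the form (φ, σ).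

record TwoFoldAut (X : Graph) : Set where
  field
    g₀ g₁    : V X ⤖ V X
    g₀g₁-adj : ∀ v w → adj X v w ⇔ adj X (to g₀ v) (to g₁ w)
    g₁g₀-adj : ∀ v w → adj X v w ⇔ adj X (to g₁ v) (to g₀ w)

module _ {X : Graph} (t : TwoFoldAut X) where
  open TwoFoldAut t

  layer : Bool → V X ⤖ V X
  layer false = g₀
  layer true  = g₁

  layer-adj : ∀ {i j} → i ≢ j → ∀ v w → adj X v w ⇔ adj X (to (layer i) v) (to (layer j) w)
  layer-adj {false} {false} i≢j = ⊥-elim (i≢j refl)
  layer-adj {false} {true}  _   = g₀g₁-adj
  layer-adj {true}  {false} _   = g₁g₀-adj
  layer-adj {true}  {true}  i≢j = ⊥-elim (i≢j refl)

  liftB : V X × Bool → V X × Bool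
  liftB (v , i) = to (layer i) v , i

  liftB-bijection : (V X × Bool) ⤖ (V X × Bool)
  liftB-bijection = mk⤖ (injective , surjective)
    where
    injective : ∀ {x y} → liftB x ≡ liftB y → x ≡ y
    injective {v , i} {w , j} eq with cong proj₂ eq
    ... | refl = cong (_, i) (Bijection.injective (layer i) (cong proj₁ eq))

    surjective : ∀ y → ∃ λ x → ∀ {z} → z ≡ x → liftB z ≡ y
    surjective (w , i) with Bijection.strictlySurjective (layer i) w
    ... | v , fv≡w = (v , i) , λ { refl → cong (_, i) fv≡w }

  twoFold⇒autB : Aut (B X)
  twoFold⇒autB = liftB-bijection , λ { (v , i) (w , j) →
      (λ (i≢j , v∼w) → i≢j , Equivalence.to   (layer-adj i≢j v w) v∼w)
    , (λ (i≢j , v∼w) → i≢j , Equivalence.from (layer-adj i≢j v w) v∼w) }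

  twoFold⇒unstable : ∀ v → to g₀ v ≢ to g₁ v → Unstable X
  twoFold⇒unstable v g₀v≢g₁v = twoFold⇒autB , λ (φ , σ , liftB≡φ×σ) →
    g₀v≢g₁v (trans (cong proj₁ (liftB≡φ×σ v false)) (sym (cong proj₁ (liftB≡φ×σ v true))))

module ℤₙ (n : ℕ) .{{_ : NonZero n}} where

  infixl 6 _+ₙ_ _⊖ₙ_

  _+ₙ_ : Fin n → Fin n → Fin n
  _+ₙ_ = _⊕_ n

  _⊖ₙ_ : Fin n → Fin n → Fin n
  _⊖ₙ_ = _⊖_ n

  -ₙ_ : Fin n → Fin n
  -ₙ a = 𝟘 n ⊖ₙ a

  0%n≡0 : 0 % n ≡ 0
  0%n≡0 = m<n⇒m%n≡m (>-nonZero⁻¹ n)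

  toℕ-mod : ∀ m → toℕ (m mod n) ≡ m % n
  toℕ-mod m = toℕ-fromℕ< (m%n<n m n)

  toℕ-𝟘 : toℕ (𝟘 n) ≡ 0
  toℕ-𝟘 = trans (toℕ-mod 0) 0%n≡0

  mod-toℕ : ∀ a → toℕ a mod n ≡ a
  mod-toℕ a = toℕ-injective (trans (toℕ-mod (toℕ a)) (m<n⇒m%n≡m (toℕ<n a)))

  mod-cong : ∀ {m m′} → m % n ≡ m′ % n → m mod n ≡ m′ mod n
  mod-cong {m} {m′} eq = toℕ-injective (trans (toℕ-mod m) (trans eq (sym (toℕ-mod m′))))

  mod-⊕ : ∀ m m′ → (m mod n) +ₙ (m′ mod n) ≡ (m + m′) mod n
  mod-⊕ m m′ = mod-cong (trans (cong₂ (λ x y → (x + y) % n) (toℕ-mod m) (toℕ-mod m′))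
                               (sym (%-distribˡ-+ m m′ n)))

  -ₙ-mod : ∀ a → -ₙ a ≡ (n ∸ toℕ a) mod n
  -ₙ-mod a = mod-cong (cong (λ x → (x + (n ∸ toℕ a)) % n) toℕ-𝟘)

  ⊖ₙ≡+ₙ-ₙ : ∀ a b → a ⊖ₙ b ≡ a +ₙ -ₙ b
  ⊖ₙ≡+ₙ-ₙ a b = begin
    a ⊖ₙ b                                 ≡⟨ mod-⊕ (toℕ a) (n ∸ toℕ b) ⟨
    (toℕ a mod n) +ₙ ((n ∸ toℕ b) mod n)   ≡⟨ cong₂ _+ₙ_ (mod-toℕ a) (sym (-ₙ-mod b)) ⟩
    a +ₙ -ₙ b                              ∎
    where open ≡-Reasoning

  +ₙ-assoc : ∀ a b c → (a +ₙ b) +ₙ c ≡ a +ₙ (b +ₙ c)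
  +ₙ-assoc a b c = begin
    (a +ₙ b) +ₙ c                         ≡⟨ cong ((a +ₙ b) +ₙ_) (mod-toℕ c) ⟨
    (a +ₙ b) +ₙ (toℕ c mod n)             ≡⟨ mod-⊕ (toℕ a + toℕ b) (toℕ c) ⟩
    (toℕ a + toℕ b + toℕ c) mod n         ≡⟨ cong (_mod n) (+-assoc (toℕ a) (toℕ b) (toℕ c)) ⟩
    (toℕ a + (toℕ b + toℕ c)) mod n       ≡⟨ mod-⊕ (toℕ a) (toℕ b + toℕ c) ⟨
    (toℕ a mod n) +ₙ (b +ₙ c)             ≡⟨ cong (_+ₙ (b +ₙ c)) (mod-toℕ a) ⟩
    a +ₙ (b +ₙ c)                         ∎
    where open ≡-Reasoning

  +ₙ-comm : ∀ a b → a +ₙ b ≡ b +ₙ a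
  +ₙ-comm a b = cong (_mod n) (+-comm (toℕ a) (toℕ b))

  +ₙ-identityˡ : ∀ a → 𝟘 n +ₙ a ≡ a
  +ₙ-identityˡ a = begin
    𝟘 n +ₙ a                 ≡⟨ cong (𝟘 n +ₙ_) (mod-toℕ a) ⟨
    𝟘 n +ₙ (toℕ a mod n)     ≡⟨ mod-⊕ 0 (toℕ a) ⟩
    toℕ a mod n              ≡⟨ mod-toℕ a ⟩
    a                        ∎
    where open ≡-Reasoning

  +ₙ-inverseʳ : ∀ a → a +ₙ -ₙ a ≡ 𝟘 n
  +ₙ-inverseʳ a = begin
    a +ₙ -ₙ a                               ≡⟨ cong₂ _+ₙ_ (mod-toℕ a) (sym (-ₙ-mod a)) ⟨
    (toℕ a mod n) +ₙ ((n ∸ toℕ a) mod n)    ≡⟨ mod-⊕ (toℕ a) (n ∸ toℕ a) ⟩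
    (toℕ a + (n ∸ toℕ a)) mod n             ≡⟨ cong (_mod n) (m+[n∸m]≡n (<⇒≤ (toℕ<n a))) ⟩
    n mod n                                 ≡⟨ mod-cong (trans (n%n≡0 n) (sym 0%n≡0)) ⟩
    𝟘 n                                     ∎
    where open ≡-Reasoning

  isAbelianGroup : IsAbelianGroup _≡_ _+ₙ_ (𝟘 n) -ₙ_
  isAbelianGroup = record
    { isGroup = record
      { isMonoid = record
        { isSemigroup = record
          { isMagma = record { isEquivalence = isEquivalence ; ∙-cong = cong₂ _+ₙ_ }
          ; assoc = +ₙ-assoc }
        ; identity = +ₙ-identityˡ , λ a → trans (+ₙ-comm a (𝟘 n)) (+ₙ-identityˡ a) }
      ; inverse = (λ a → trans (+ₙ-comm (-ₙ a) a) (+ₙ-inverseʳ a)) , +ₙ-inverseʳ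
      ; ⁻¹-cong = cong -ₙ_ }
    ; comm = +ₙ-comm }

  abelianGroup : AbelianGroup 0ℓ 0ℓ
  abelianGroup = record { isAbelianGroup = isAbelianGroup }

module _ {a ℓ} (G : AbelianGroup a ℓ) where
  open AbelianGroup G using (_≈_; _∙_; ε; _⁻¹; _-_; assoc; comm; identityʳ; ∙-congˡ; setoid)
  open AbelianGroupProperties G using (inverseʳ-unique; ⁻¹-∙-comm)
  open SetoidReasoning setoid

  x∙h∙h≈x : ∀ {h} → h ∙ h ≈ ε → ∀ x → x ∙ h ∙ h ≈ x
  x∙h∙h≈x {h} h∙h≈ε x = begin
    x ∙ h ∙ h    ≈⟨ assoc x h h ⟩
    x ∙ (h ∙ h)  ≈⟨ ∙-congˡ h∙h≈ε ⟩
    x ∙ ε        ≈⟨ identityʳ x ⟩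
    x            ∎

  [x∙h]-y≈[x-y]-h : ∀ {h} → h ∙ h ≈ ε → ∀ x y → (x ∙ h) - y ≈ (x - y) - h
  [x∙h]-y≈[x-y]-h {h} h∙h≈ε x y = begin
    x ∙ h ∙ y ⁻¹      ≈⟨ assoc x h (y ⁻¹) ⟩
    x ∙ (h ∙ y ⁻¹)    ≈⟨ ∙-congˡ (comm h (y ⁻¹)) ⟩
    x ∙ (y ⁻¹ ∙ h)    ≈⟨ assoc x (y ⁻¹) h ⟨
    x ∙ y ⁻¹ ∙ h      ≈⟨ ∙-congˡ (inverseʳ-unique h h h∙h≈ε) ⟩
    x ∙ y ⁻¹ ∙ h ⁻¹   ∎

  x-[y∙h]≈[x-y]-h : ∀ x y h → x - (y ∙ h) ≈ (x - y) - h
  x-[y∙h]≈[x-y]-h x y h = begin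
    x ∙ (y ∙ h) ⁻¹       ≈⟨ ∙-congˡ (⁻¹-∙-comm y h) ⟨
    x ∙ (y ⁻¹ ∙ h ⁻¹)    ≈⟨ assoc x (y ⁻¹) (h ⁻¹) ⟨
    x ∙ y ⁻¹ ∙ h ⁻¹      ∎

module _ (n : ℕ) .{{_ : NonZero n}} {h : Fin n} (h⊕h≡𝟘 : _⊕_ n h h ≡ 𝟘 n) where
  open ℤₙ n using (_+ₙ_; _⊖ₙ_; ⊖ₙ≡+ₙ-ₙ; abelianGroup)
  open AbelianGroup abelianGroup using (_-_)
  open AbelianGroupProperties abelianGroup using (identityʳ-unique)

  [x⊖y]⊖h≡[x-y]-h : ∀ x y → (x ⊖ₙ y) ⊖ₙ h ≡ (x - y) - h
  [x⊖y]⊖h≡[x-y]-h x y = trans (⊖ₙ≡+ₙ-ₙ (x ⊖ₙ y) h) (cong (_- h) (⊖ₙ≡+ₙ-ₙ x y))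

  [x⊕h]⊖y≡[x⊖y]⊖h : ∀ x y → (x +ₙ h) ⊖ₙ y ≡ (x ⊖ₙ y) ⊖ₙ h
  [x⊕h]⊖y≡[x⊖y]⊖h x y = begin
    (x +ₙ h) ⊖ₙ y    ≡⟨ ⊖ₙ≡+ₙ-ₙ (x +ₙ h) y ⟩
    (x +ₙ h) - y     ≡⟨ [x∙h]-y≈[x-y]-h abelianGroup h⊕h≡𝟘 x y ⟩
    (x - y) - h      ≡⟨ [x⊖y]⊖h≡[x-y]-h x y ⟨
    (x ⊖ₙ y) ⊖ₙ h    ∎
    where open ≡-Reasoning

  x⊖[y⊕h]≡[x⊖y]⊖h : ∀ x y → x ⊖ₙ (y +ₙ h) ≡ (x ⊖ₙ y) ⊖ₙ h
  x⊖[y⊕h]≡[x⊖y]⊖h x y = begin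
    x ⊖ₙ (y +ₙ h)    ≡⟨ ⊖ₙ≡+ₙ-ₙ x (y +ₙ h) ⟩
    x - (y +ₙ h)     ≡⟨ x-[y∙h]≈[x-y]-h abelianGroup x y h ⟩
    (x - y) - h      ≡⟨ [x⊖y]⊖h≡[x-y]-h x y ⟨
    (x ⊖ₙ y) ⊖ₙ h    ∎
    where open ≡-Reasoning

  +h-bijection : Fin n ⤖ Fin n
  +h-bijection = ↔⇒⤖ (mk↔ₛ′ (_+ₙ h) (_+ₙ h) (x∙h∙h≈x abelianGroup h⊕h≡𝟘) (x∙h∙h≈x abelianGroup h⊕h≡𝟘))

  module _ (S : Fin n → Bool) (X≅X+h : Cay n S ≅ Cay n (shift n S h)) where

    f : Fin n ⤖ Fin n
    f = proj₁ X≅X+h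

    f-adj⇔ : ∀ v w → S (w ⊖ₙ v) ≡ true ⇔ S ((to f w ⊖ₙ to f v) ⊖ₙ h) ≡ true
    f-adj⇔ v w = mk⇔ (proj₁ (proj₂ X≅X+h v w)) (proj₂ (proj₂ X≅X+h v w))

    shiftIso⇒twoFoldAut : TwoFoldAut (Cay n S)
    shiftIso⇒twoFoldAut = record
      { g₀ = f
      ; g₁ = +h-bijection ⤖-∘ f
      ; g₀g₁-adj = λ v w → subst (λ x → _ ⇔ S x ≡ true)
                                 (sym ([x⊕h]⊖y≡[x⊖y]⊖h (to f w) (to f v))) (f-adj⇔ v w)
      ; g₁g₀-adj = λ v w → subst (λ x → _ ⇔ S x ≡ true)
                                 (sym (x⊖[y⊕h]≡[x⊖y]⊖h (to f w) (to f v))) (f-adj⇔ v w)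
      }

    shiftIso⇒unstable : h ≢ 𝟘 n → Unstable (Cay n S)
    shiftIso⇒unstable h≢𝟘 = twoFold⇒unstable shiftIso⇒twoFoldAut (𝟘 n)
      λ f𝟘≡f𝟘+h → h≢𝟘 (identityʳ-unique (to f (𝟘 n)) h (sym f𝟘≡f𝟘+h))

toℕ-half : ∀ k → toℕ (half k) ≡ suc k
toℕ-half k = toℕ-fromℕ< (m<m+n (suc k) z<s)

half⊕half≡𝟘 : ∀ k → _⊕_ (suc k + suc k) (half k) (half k) ≡ 𝟘 (suc k + suc k)
half⊕half≡𝟘 k = mod-cong {toℕ (half k) + toℕ (half k)} {0} (begin
    (toℕ (half k) + toℕ (half k)) % n   ≡⟨ cong (λ x → (x + x) % n) (toℕ-half k) ⟩
    n % n                               ≡⟨ n%n≡0 n ⟩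
    0                                   ≡⟨ 0%n≡0 ⟨
    0 % n                               ∎)
  where
  n : ℕ
  n = suc k + suc k
  open ℤₙ n using (mod-cong; 0%n≡0)
  open ≡-Reasoning

half≢𝟘 : ∀ k → half k ≢ 𝟘 (suc k + suc k)
half≢𝟘 k half≡𝟘 with trans (sym (toℕ-half k)) (trans (cong toℕ half≡𝟘) (ℤₙ.toℕ-𝟘 (suc k + suc k)))
... | ()

proposition3p7 : (k : ℕ) (S : Fin (suc k + suc k) → Bool) →
    IsConnectionSet (suc k + suc k) S →
    Cay (suc k + suc k) S ≅ Cay (suc k + suc k) (shift (suc k + suc k) S (half k)) →
    Unstable (Cay (suc k + suc k) S)
proposition3p7 k S _ X≅X+n/2 = shiftIso⇒unstable (suc k + suc k) (half⊕half≡𝟘 k) S X≅X+n/2 (half≢𝟘 k)
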